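{- Let $q=p^h$ with $p>3$ prime, let $m$ be a proper divisor of $q-1$ with $\gcd(m,6)=1$, and let $t\in\mathbb{F}_q^*$ be not an $m$-th power in $\mathbb{F}_q$. Let $\mathcal X$ be the cubic $XY=(X-1)^3$ and $$K_t=\Big\{\big(tw^m,\tfrac{(tw^m-1)^3}{tw^m}\big)\;:\; w\in\mathbb{F}_q^*\Big\}.$$ Let $P=(a,b)$ be a point of $AG(2,q)$ not on $\mathcal X$ (i.e. $ab\neq(a-1)^3$), and let $$f_{a,b,t,m}(X,Y)=a(t^3X^{2m}Y^m+t^3X^mY^{2m}-3t^2X^mY^m+1)-bt^2X^mY^m-t^4X^{2m}Y^{2m}+3t^2X^mY^m-tX^m-tY^m.$$ Then $P$ is collinear with two distinct points of $K_t$ if and only if there exist $\tilde x,\tilde y\in\mathbb{F}_q^*$ with $\tilde x^m\neq\tilde y^m$ such that $f_{a,b,t,m}(\tilde x,\tilde y)=0$. -}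

module Defs where

open import Data.Nat as ℕ using (ℕ; zero; suc)
open import Data.Product using (Σ; ∃; _×_; _,_; proj₁; proj₂)
open import Relation.Nullary using (¬_)
open import Relation.Binary.PropositionalEquality using (_≡_)
open import Algebra.Structures using (IsCommutativeRing)

-- A field (carrier with propositional equality). The inverse is a total
-- function whose value at 0 is irrelevant; it is the multiplicative inverse
-- on nonzero elements.
record Field : Set₁ where
  infixl 6 _+_ _-_
  infixl 7 _*_
  infix  8 -_ _⁻¹
  field
    Carrier : Set
    _+_ _*_ : Carrier → Carrier → Carrier
    -_ : Carrier → Carrier
    0# 1# : Carrier
    _⁻¹ : Carrier → Carrier
    isCommutativeRing : IsCommutativeRing _≡_ _+_ _*_ -_ 0# 1#
    0≢1 : ¬ (0# ≡ 1#)
    ⁻¹-inverse : ∀ x → ¬ (x ≡ 0#) → x * x ⁻¹ ≡ 1#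

  _-_ : Carrier → Carrier → Carrier
  x - y = x + (- y)

  infixr 8 _^_
  _^_ : Carrier → ℕ → Carrier
  x ^ zero  = 1#
  x ^ suc n = x * (x ^ n)

  2# 3# : Carrier
  2# = 1# + 1#
  3# = 1# + 1# + 1#

  Point : Set
  Point = Carrier × Carrier

module _ (F : Field) where
  open Field F

  IsPower : ℕ → Carrier → Set
  IsPower m t = ∃ λ s → s ^ m ≡ t

  OnCubic : Point → Set
  OnCubic (a , b) = a * b ≡ (a - 1#) ^ 3

  InK : ℕ → Carrier → Point → Set
  InK m t Q = ∃ λ w → ¬ (w ≡ 0#) ×
    Q ≡ (t * w ^ m , ((t * w ^ m - 1#) ^ 3) * (t * w ^ m) ⁻¹)

  OnLine : Carrier → Carrier → Carrier → Point → Set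
  OnLine α β γ (x , y) = α * x + β * y + γ ≡ 0#

  Collinear : Point → Point → Point → Set
  Collinear P Q R = ∃ λ α → ∃ λ β → ∃ λ γ →
    ¬ (α ≡ 0# × β ≡ 0#) × OnLine α β γ P × OnLine α β γ Q × OnLine α β γ R

  CollinearWithTwoOfK : ℕ → Carrier → Point → Set
  CollinearWithTwoOfK m t P = ∃ λ Q → ∃ λ R →
    InK m t Q × InK m t R × ¬ (Q ≡ R) × Collinear P Q R

  f : Carrier → Carrier → Carrier → ℕ → Carrier → Carrier → Carrier
  f a b t m X Y =
      a * (t ^ 3 * X ^ (2 ℕ.* m) * Y ^ m + t ^ 3 * X ^ m * Y ^ (2 ℕ.* m)
           - 3# * t ^ 2 * X ^ m * Y ^ m + 1#)
    - b * t ^ 2 * X ^ m * Y ^ m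
    - t ^ 4 * X ^ (2 ℕ.* m) * Y ^ (2 ℕ.* m)
    + 3# * t ^ 2 * X ^ m * Y ^ m
    - t * X ^ m
    - t * Y ^ m

-- A point of K_t is (x, (x - 1)³/x) with x = t wᵐ ≠ 0, so distinct points of K_t have distinct
-- abscissae x₁ ≠ x₂, i.e. w₁ᵐ ≠ w₂ᵐ. Multiplying the collinearity determinant of (a, b),
-- (x₁, y₁), (x₂, y₂) by x₁ x₂ clears the denominators and factors it as (x₁ - x₂) g(x₁, x₂)
-- for a cubic g with f(X, Y) = g(t Xᵐ, t Yᵐ). Hence, for distinct points, collinearity is
-- equivalent to g(x₁, x₂) = 0, that is, to f(w₁, w₂) = 0.
module Submission where

open import Defs
open import Data.Nat using (ℕ; _∸_; _<_)
open import Data.Nat.Divisibility using (_∣_)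
open import Data.Nat.GCD using (gcd)
open import Data.Nat.Primality using (Prime)
open import Data.Fin using (Fin)
open import Data.Product using (∃; _,_)
open import Function.Bundles using (_↔_)
open import Relation.Nullary using (¬_)
open import Relation.Binary.PropositionalEquality using (_≡_)

open import Algebra.Bundles using (CommutativeRing)
open import Algebra.Bundles.Raw using (RawRing)
open import Algebra.Solver.Ring.AlmostCommutativeRing
  using (fromCommutativeRing; _-Raw-AlmostCommutative⟶_)
open import Data.Empty using (⊥-elim)
open import Data.Fin.Properties using (inj⇒≟)
open import Data.Integer.Base as ℤ using (ℤ; +_; -[1+_]; _⊖_; _◃_)
import Data.Integer.Properties as ℤ
open import Data.Maybe.Base using (Maybe; map)
open import Data.Nat.Base as ℕ using (zero; suc)
import Data.Nat.Properties as ℕ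
open import Data.Product.Base using (proj₁; proj₂)
import Data.Sign.Base as Sign
open import Function.Base using (_∘_)
open import Function.Properties.Inverse using (↔⇒↣)
open import Relation.Binary.Consequences using (dec⇒weaklyDec)
open import Relation.Binary.Definitions using (DecidableEquality)
import Relation.Binary.PropositionalEquality as ≡
open import Relation.Nullary using (yes; no)

-- The solver proves an identity by computing normal forms, so its coefficients must come
-- from a ring with computable equality; ℤ maps into every commutative ring.
module IntegerCoefficientSolver {c ℓ} (R : CommutativeRing c ℓ) where
  open CommutativeRing R
  open import Algebra.Properties.Ring ring
    using (-0#≈0#; -‿involutive; -‿+-comm; -‿distribˡ-*; -‿distribʳ-*)
  open import Algebra.Properties.Semiring.Mult.TCOptimised semiring
    using (_×_; 1+×; ×-homo-+; ×1-homo-*)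
  open import Algebra.Properties.CommutativeSemigroup +-commutativeSemigroup
    using (interchange)
  open import Relation.Binary.Reasoning.Setoid setoid

  fromℤ : ℤ → Carrier
  fromℤ (+ n)    = n × 1#
  fromℤ -[1+ n ] = - (suc n × 1#)

  -‿cancel-1+ : ∀ x y → x - y ≈ (1# + x) - (1# + y)
  -‿cancel-1+ x y = begin
    x - y                ≈⟨ +-identityˡ (x - y) ⟨
    0# + (x - y)         ≈⟨ +-congʳ (-‿inverseʳ 1#) ⟨
    (1# - 1#) + (x - y)  ≈⟨ interchange 1# (- 1#) x (- y) ⟩
    (1# + x) + (- 1# - y) ≈⟨ +-congˡ (-‿+-comm 1# y) ⟩
    (1# + x) - (1# + y)  ∎

  fromℤ-⊖ : ∀ m n → fromℤ (m ⊖ n) ≈ m × 1# - n × 1#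
  fromℤ-⊖ m       zero    = sym (trans (+-congˡ -0#≈0#) (+-identityʳ _))
  fromℤ-⊖ zero    (suc n) = sym (+-identityˡ _)
  fromℤ-⊖ (suc m) (suc n) = begin
    fromℤ (suc m ⊖ suc n)           ≡⟨ ≡.cong fromℤ (ℤ.[1+m]⊖[1+n]≡m⊖n m n) ⟩
    fromℤ (m ⊖ n)                   ≈⟨ fromℤ-⊖ m n ⟩
    m × 1# - n × 1#                 ≈⟨ -‿cancel-1+ (m × 1#) (n × 1#) ⟩
    (1# + m × 1#) - (1# + n × 1#)   ≈⟨ +-cong (1+× m 1#) (-‿cong (1+× n 1#)) ⟨
    suc m × 1# - suc n × 1#         ∎

  fromℤ-+◃ : ∀ n → fromℤ (Sign.+ ◃ n) ≈ n × 1#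
  fromℤ-+◃ zero    = refl
  fromℤ-+◃ (suc n) = refl

  fromℤ--◃ : ∀ n → fromℤ (Sign.- ◃ n) ≈ - (n × 1#)
  fromℤ--◃ zero    = sym -0#≈0#
  fromℤ--◃ (suc n) = refl

  fromℤ-+ : ∀ i j → fromℤ (i ℤ.+ j) ≈ fromℤ i + fromℤ j
  fromℤ-+ (+ m)    (+ n)    = ×-homo-+ 1# m n
  fromℤ-+ (+ m)    -[1+ n ] = fromℤ-⊖ m (suc n)
  fromℤ-+ -[1+ m ] (+ n)    = trans (fromℤ-⊖ n (suc m)) (+-comm _ _)
  fromℤ-+ -[1+ m ] -[1+ n ] = begin
    - (suc (suc (m ℕ.+ n)) × 1#)     ≡⟨ ≡.cong (λ k → - (suc k × 1#)) (ℕ.+-suc m n) ⟨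
    - ((suc m ℕ.+ suc n) × 1#)       ≈⟨ -‿cong (×-homo-+ 1# (suc m) (suc n)) ⟩
    - (suc m × 1# + suc n × 1#)      ≈⟨ -‿+-comm _ _ ⟨
    - (suc m × 1#) + - (suc n × 1#)  ∎

  fromℤ-* : ∀ i j → fromℤ (i ℤ.* j) ≈ fromℤ i * fromℤ j
  fromℤ-* (+ m)    (+ n)    = trans (fromℤ-+◃ (m ℕ.* n)) (×1-homo-* m n)
  fromℤ-* (+ m)    -[1+ n ] = begin
    fromℤ (Sign.- ◃ m ℕ.* suc n)  ≈⟨ fromℤ--◃ (m ℕ.* suc n) ⟩
    - ((m ℕ.* suc n) × 1#)        ≈⟨ -‿cong (×1-homo-* m (suc n)) ⟩
    - (m × 1# * suc n × 1#)       ≈⟨ -‿distribʳ-* _ _ ⟩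
    m × 1# * - (suc n × 1#)       ∎
  fromℤ-* -[1+ m ] (+ n)    = begin
    fromℤ (Sign.- ◃ suc m ℕ.* n)  ≈⟨ fromℤ--◃ (suc m ℕ.* n) ⟩
    - ((suc m ℕ.* n) × 1#)        ≈⟨ -‿cong (×1-homo-* (suc m) n) ⟩
    - (suc m × 1# * n × 1#)       ≈⟨ -‿distribˡ-* _ _ ⟩
    - (suc m × 1#) * n × 1#       ∎
  fromℤ-* -[1+ m ] -[1+ n ] = begin
    fromℤ (Sign.+ ◃ suc m ℕ.* suc n)  ≈⟨ fromℤ-+◃ (suc m ℕ.* suc n) ⟩
    (suc m ℕ.* suc n) × 1#            ≈⟨ ×1-homo-* (suc m) (suc n) ⟩
    x * y                             ≈⟨ -‿involutive (x * y) ⟨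
    - - (x * y)                       ≈⟨ -‿cong (-‿distribˡ-* x y) ⟩
    - (- x * y)                       ≈⟨ -‿distribʳ-* (- x) y ⟩
    - x * - y                         ∎
    where
    x y : Carrier
    x = suc m × 1#
    y = suc n × 1#

  fromℤ-- : ∀ i → fromℤ (ℤ.- i) ≈ - fromℤ i
  fromℤ-- (+ zero)  = sym -0#≈0#
  fromℤ-- (+ suc n) = refl
  fromℤ-- -[1+ n ]  = sym (-‿involutive _)

  fromℤ-morphism : ℤ.+-*-rawRing -Raw-AlmostCommutative⟶ fromCommutativeRing R
  fromℤ-morphism = record
    { ⟦_⟧    = fromℤ
    ; +-homo = fromℤ-+
    ; *-homo = fromℤ-*
    ; -‿homo = fromℤ--
    ; 0-homo = refl
    ; 1-homo = refl
    }

  fromℤ-≟ : ∀ i j → Maybe (fromℤ i ≈ fromℤ j)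
  fromℤ-≟ i j = map (reflexive ∘ ≡.cong fromℤ) (dec⇒weaklyDec ℤ._≟_ i j)

  open import Algebra.Solver.Ring ℤ.+-*-rawRing (fromCommutativeRing R) fromℤ-morphism fromℤ-≟ public

-- Stated over an arbitrary raw ring so that the same expressions can be read in F and, for
-- the solver, as polynomials.
module Expressions {c ℓ} (R : RawRing c ℓ) where
  open RawRing R
  open import Data.Product.Base using (_×_)
  open import Algebra.Definitions.RawSemiring rawSemiring using (_^_)

  infixl 6 _-_
  _-_ : Carrier → Carrier → Carrier
  x - y = x + - y

  3# : Carrier
  3# = 1# + 1# + 1#

  det : Carrier × Carrier → Carrier × Carrier → Carrier × Carrier → Carrier
  det (a , b) (x₁ , y₁) (x₂ , y₂) = (x₁ - a) * (y₂ - b) - (x₂ - a) * (y₁ - b)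

  lineValue : Carrier → Carrier → Carrier → Carrier × Carrier → Carrier
  lineValue α β γ (x , y) = α * x + β * y + γ

  secant : Carrier → Carrier → Carrier → Carrier → Carrier
  secant a b x₁ x₂ =
      a * (x₁ * x₁ * x₂ + x₁ * x₂ * x₂ - 3# * x₁ * x₂ + 1#)
    - b * x₁ * x₂ - x₁ * x₁ * x₂ * x₂ + 3# * x₁ * x₂ - x₁ - x₂

  fShape : Carrier → Carrier → Carrier → Carrier → Carrier → Carrier → Carrier → Carrier
  fShape a b t u₁ u₂ v₁ v₂ =
      a * (t ^ 3 * v₁ * u₂ + t ^ 3 * u₁ * v₂ - 3# * t ^ 2 * u₁ * u₂ + 1#)
    - b * t ^ 2 * u₁ * u₂ - t ^ 4 * v₁ * v₂ + 3# * t ^ 2 * u₁ * u₂ - t * u₁ - t * u₂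

module FieldProperties (F : Field) where
  open Field F
  open ≡ using (refl)
  open import Data.Product.Base using (_×_)

  commutativeRing : CommutativeRing _ _
  commutativeRing = record { isCommutativeRing = isCommutativeRing }

  open CommutativeRing commutativeRing
    using (rawRing; ring; *-assoc; *-comm; *-identityˡ; *-identityʳ; zeroˡ; zeroʳ; -‿inverseʳ)
  open import Algebra.Properties.Ring ring using (x[y-z]≈xy-xz; x∙y⁻¹≈ε⇒x≈y; -0#≈0#)

  open IntegerCoefficientSolver commutativeRing
    using (Polynomial; con; _:+_; _:*_; :-_; _:-_; _:^_; _:=_; solve)
  open Expressions rawRing using (det; lineValue; secant; fShape)

  polynomials : ℕ → RawRing _ _
  polynomials n = record
    { Carrier = Polynomial n ; _≈_ = _≡_ ; _+_ = _:+_ ; _*_ = _:*_ ; -_ = :-_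
    ; 0# = con (+ 0) ; 1# = con (+ 1) }

  module Poly {n : ℕ} = Expressions (polynomials n)

  open ≡.≡-Reasoning

  x*y≡0⇒y≡0 : ∀ {x y} → ¬ x ≡ 0# → x * y ≡ 0# → y ≡ 0#
  x*y≡0⇒y≡0 {x} {y} x≢0 xy≡0 = begin
    y                ≡⟨ *-identityˡ y ⟨
    1# * y           ≡⟨ ≡.cong (_* y) (⁻¹-inverse x x≢0) ⟨
    (x * x ⁻¹) * y   ≡⟨ ≡.cong (_* y) (*-comm x (x ⁻¹)) ⟩
    (x ⁻¹ * x) * y   ≡⟨ *-assoc (x ⁻¹) x y ⟩
    x ⁻¹ * (x * y)   ≡⟨ ≡.cong (x ⁻¹ *_) xy≡0 ⟩
    x ⁻¹ * 0#        ≡⟨ zeroʳ (x ⁻¹) ⟩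
    0#               ∎

  x*y≡0⇒x≡0 : ∀ {x y} → ¬ y ≡ 0# → x * y ≡ 0# → x ≡ 0#
  x*y≡0⇒x≡0 {x} {y} y≢0 xy≡0 = x*y≡0⇒y≡0 y≢0 (≡.trans (*-comm y x) xy≡0)

  *-nonzero : ∀ {x y} → ¬ x ≡ 0# → ¬ y ≡ 0# → ¬ x * y ≡ 0#
  *-nonzero x≢0 y≢0 = y≢0 ∘ x*y≡0⇒y≡0 x≢0

  ^-nonzero : ∀ {x} n → ¬ x ≡ 0# → ¬ x ^ n ≡ 0#
  ^-nonzero zero    x≢0 = 0≢1 ∘ ≡.sym
  ^-nonzero (suc n) x≢0 = *-nonzero x≢0 (^-nonzero n x≢0)

  *-cancelˡ : ∀ {t u v} → ¬ t ≡ 0# → t * u ≡ t * v → u ≡ v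
  *-cancelˡ {t} {u} {v} t≢0 tu≡tv = x∙y⁻¹≈ε⇒x≈y u v (x*y≡0⇒y≡0 t≢0 (begin
    t * (u - v)     ≡⟨ x[y-z]≈xy-xz t u v ⟩
    t * u - t * v   ≡⟨ ≡.cong (_- t * v) tu≡tv ⟩
    t * v - t * v   ≡⟨ -‿inverseʳ (t * v) ⟩
    0#              ∎))

  ^-+ : ∀ x m n → x ^ (m ℕ.+ n) ≡ x ^ m * x ^ n
  ^-+ x zero    n = ≡.sym (*-identityˡ (x ^ n))
  ^-+ x (suc m) n = ≡.trans (≡.cong (x *_) (^-+ x m n)) (≡.sym (*-assoc x (x ^ m) (x ^ n)))

  ^-double : ∀ x m → x ^ (2 ℕ.* m) ≡ x ^ m * x ^ m
  ^-double x m = ≡.trans (^-+ x m (m ℕ.+ 0)) (≡.cong (λ k → x ^ m * x ^ k) (ℕ.+-identityʳ m))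

  vanish-combination : ∀ {e₁ e₂} p q → e₁ ≡ 0# → e₂ ≡ 0# → e₁ * p - e₂ * q ≡ 0#
  vanish-combination p q e₁≡0 e₂≡0 = begin
    _ * p - _ * q     ≡⟨ ≡.cong₂ (λ e₁ e₂ → e₁ * p - e₂ * q) e₁≡0 e₂≡0 ⟩
    0# * p - 0# * q   ≡⟨ ≡.cong₂ _-_ (zeroˡ p) (zeroˡ q) ⟩
    0# - 0#           ≡⟨ -‿inverseʳ 0# ⟩
    0#                ∎

  α*det-identity : ∀ α β γ a b x₁ y₁ x₂ y₂ → let ℓ = lineValue α β γ in
    α * det (a , b) (x₁ , y₁) (x₂ , y₂)
      ≡ (ℓ (x₁ , y₁) - ℓ (a , b)) * (y₂ - b) - (ℓ (x₂ , y₂) - ℓ (a , b)) * (y₁ - b)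
  α*det-identity = solve 9 (λ α β γ a b x₁ y₁ x₂ y₂ → let ℓ = Poly.lineValue α β γ in
    α :* Poly.det (a , b) (x₁ , y₁) (x₂ , y₂)
      := (ℓ (x₁ , y₁) :- ℓ (a , b)) :* (y₂ :- b) :- (ℓ (x₂ , y₂) :- ℓ (a , b)) :* (y₁ :- b)) refl

  β*det-identity : ∀ α β γ a b x₁ y₁ x₂ y₂ → let ℓ = lineValue α β γ in
    β * det (a , b) (x₁ , y₁) (x₂ , y₂)
      ≡ (ℓ (x₂ , y₂) - ℓ (a , b)) * (x₁ - a) - (ℓ (x₁ , y₁) - ℓ (a , b)) * (x₂ - a)
  β*det-identity = solve 9 (λ α β γ a b x₁ y₁ x₂ y₂ → let ℓ = Poly.lineValue α β γ in
    β :* Poly.det (a , b) (x₁ , y₁) (x₂ , y₂)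
      := (ℓ (x₂ , y₂) :- ℓ (a , b)) :* (x₁ :- a) :- (ℓ (x₁ , y₁) :- ℓ (a , b)) :* (x₂ :- a)) refl

  collinear⇒det≡0 : DecidableEquality Carrier →
                    ∀ {P Q R} → Collinear F P Q R → det P Q R ≡ 0#
  collinear⇒det≡0 _≟_ {a , b} {x₁ , y₁} {x₂ , y₂} (α , β , γ , αβ≢0 , onP , onQ , onR)
    with det (a , b) (x₁ , y₁) (x₂ , y₂) ≟ 0#
  ... | yes d≡0 = d≡0
  ... | no  d≢0 = ⊥-elim (αβ≢0 (x*y≡0⇒x≡0 d≢0 α*d≡0 , x*y≡0⇒x≡0 d≢0 β*d≡0))
    where
    d : Carrier
    d = det (a , b) (x₁ , y₁) (x₂ , y₂)
    ℓ-ℓ₀≡0 : ∀ {S} → OnLine F α β γ S → lineValue α β γ S - lineValue α β γ (a , b) ≡ 0#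
    ℓ-ℓ₀≡0 onS = ≡.trans (≡.cong₂ _-_ onS onP) (-‿inverseʳ 0#)
    α*d≡0 : α * d ≡ 0#
    α*d≡0 = ≡.trans (α*det-identity α β γ a b x₁ y₁ x₂ y₂)
                    (vanish-combination (y₂ - b) (y₁ - b) (ℓ-ℓ₀≡0 onQ) (ℓ-ℓ₀≡0 onR))
    β*d≡0 : β * d ≡ 0#
    β*d≡0 = ≡.trans (β*det-identity α β γ a b x₁ y₁ x₂ y₂)
                    (vanish-combination (x₁ - a) (x₂ - a) (ℓ-ℓ₀≡0 onR) (ℓ-ℓ₀≡0 onQ))

  lineThrough-value≡-det : ∀ a b x₁ y₁ x₂ y₂ →
    lineValue (y₂ - y₁) (x₁ - x₂) (- ((y₂ - y₁) * x₁ + (x₁ - x₂) * y₁)) (a , b)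
      ≡ - det (a , b) (x₁ , y₁) (x₂ , y₂)
  lineThrough-value≡-det = solve 6 (λ a b x₁ y₁ x₂ y₂ →
    Poly.lineValue (y₂ :- y₁) (x₁ :- x₂) (:- ((y₂ :- y₁) :* x₁ :+ (x₁ :- x₂) :* y₁)) (a , b)
      := :- Poly.det (a , b) (x₁ , y₁) (x₂ , y₂)) refl

  lineThrough-value-second≡0 : ∀ x₁ y₁ x₂ y₂ →
    lineValue (y₂ - y₁) (x₁ - x₂) (- ((y₂ - y₁) * x₁ + (x₁ - x₂) * y₁)) (x₂ , y₂) ≡ 0#
  lineThrough-value-second≡0 = solve 4 (λ x₁ y₁ x₂ y₂ →
    Poly.lineValue (y₂ :- y₁) (x₁ :- x₂) (:- ((y₂ :- y₁) :* x₁ :+ (x₁ :- x₂) :* y₁)) (x₂ , y₂)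
      := con (+ 0)) refl

  det≡0⇒collinear : ∀ {P Q R} → ¬ proj₁ Q ≡ proj₁ R → det P Q R ≡ 0# → Collinear F P Q R
  det≡0⇒collinear {a , b} {x₁ , y₁} {x₂ , y₂} x₁≢x₂ d≡0 =
      α , β , γ , x₁≢x₂ ∘ x∙y⁻¹≈ε⇒x≈y x₁ x₂ ∘ proj₂
    , ≡.trans (lineThrough-value≡-det a b x₁ y₁ x₂ y₂) (≡.trans (≡.cong -_ d≡0) -0#≈0#)
    , -‿inverseʳ (α * x₁ + β * y₁)
    , lineThrough-value-second≡0 x₁ y₁ x₂ y₂
    where
    α β γ : Carrier
    α = y₂ - y₁
    β = x₁ - x₂
    γ = - (α * x₁ + β * y₁)

  cubicY : Carrier → Carrier
  cubicY x = (x - 1#) ^ 3 * x ⁻¹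

  cubicPoint : Carrier → Point
  cubicPoint x = x , cubicY x

  cubicY*x≡[x-1]³ : ∀ {x} → ¬ x ≡ 0# → cubicY x * x ≡ (x - 1#) ^ 3
  cubicY*x≡[x-1]³ {x} x≢0 = begin
    (x - 1#) ^ 3 * x ⁻¹ * x     ≡⟨ *-assoc ((x - 1#) ^ 3) (x ⁻¹) x ⟩
    (x - 1#) ^ 3 * (x ⁻¹ * x)   ≡⟨ ≡.cong ((x - 1#) ^ 3 *_) (≡.trans (*-comm (x ⁻¹) x) (⁻¹-inverse x x≢0)) ⟩
    (x - 1#) ^ 3 * 1#           ≡⟨ *-identityʳ _ ⟩
    (x - 1#) ^ 3                ∎

  det-cubicPoints : ∀ a b {x₁ x₂} → ¬ x₁ ≡ 0# → ¬ x₂ ≡ 0# →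
    det (a , b) (cubicPoint x₁) (cubicPoint x₂) * (x₁ * x₂) ≡ (x₁ - x₂) * secant a b x₁ x₂
  det-cubicPoints a b {x₁} {x₂} x₁≢0 x₂≢0 = begin
    det (a , b) (x₁ , y₁) (x₂ , y₂) * (x₁ * x₂)
      ≡⟨ clear-denominators a b x₁ y₁ x₂ y₂ ⟩
    (x₁ - a) * x₁ * (y₂ * x₂ - b * x₂) - (x₂ - a) * x₂ * (y₁ * x₁ - b * x₁)
      ≡⟨ ≡.cong₂ (λ c₁ c₂ → (x₁ - a) * x₁ * (c₂ - b * x₂) - (x₂ - a) * x₂ * (c₁ - b * x₁))
                 (cubicY*x≡[x-1]³ x₁≢0) (cubicY*x≡[x-1]³ x₂≢0) ⟩
    (x₁ - a) * x₁ * ((x₂ - 1#) ^ 3 - b * x₂) - (x₂ - a) * x₂ * ((x₁ - 1#) ^ 3 - b * x₁)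
      ≡⟨ factor-secant a b x₁ x₂ ⟩
    (x₁ - x₂) * secant a b x₁ x₂
      ∎
    where
    y₁ y₂ : Carrier
    y₁ = cubicY x₁
    y₂ = cubicY x₂
    clear-denominators : ∀ a b x₁ y₁ x₂ y₂ →
      det (a , b) (x₁ , y₁) (x₂ , y₂) * (x₁ * x₂)
        ≡ (x₁ - a) * x₁ * (y₂ * x₂ - b * x₂) - (x₂ - a) * x₂ * (y₁ * x₁ - b * x₁)
    clear-denominators = solve 6 (λ a b x₁ y₁ x₂ y₂ →
      Poly.det (a , b) (x₁ , y₁) (x₂ , y₂) :* (x₁ :* x₂)
        := (x₁ :- a) :* x₁ :* (y₂ :* x₂ :- b :* x₂) :- (x₂ :- a) :* x₂ :* (y₁ :* x₁ :- b :* x₁)) refl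
    factor-secant : ∀ a b x₁ x₂ →
      (x₁ - a) * x₁ * ((x₂ - 1#) ^ 3 - b * x₂) - (x₂ - a) * x₂ * ((x₁ - 1#) ^ 3 - b * x₁)
        ≡ (x₁ - x₂) * secant a b x₁ x₂
    factor-secant = solve 4 (λ a b x₁ x₂ →
      (x₁ :- a) :* x₁ :* ((x₂ :- con (+ 1)) :^ 3 :- b :* x₂)
        :- (x₂ :- a) :* x₂ :* ((x₁ :- con (+ 1)) :^ 3 :- b :* x₁)
        := (x₁ :- x₂) :* Poly.secant a b x₁ x₂) refl

  f≡secant : ∀ a b t m X Y → f F a b t m X Y ≡ secant a b (t * X ^ m) (t * Y ^ m)
  f≡secant a b t m X Y = begin
    f F a b t m X Y
      ≡⟨⟩
    fShape a b t (X ^ m) (Y ^ m) (X ^ (2 ℕ.* m)) (Y ^ (2 ℕ.* m))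
      ≡⟨ ≡.cong₂ (fShape a b t (X ^ m) (Y ^ m)) (^-double X m) (^-double Y m) ⟩
    fShape a b t (X ^ m) (Y ^ m) (X ^ m * X ^ m) (Y ^ m * Y ^ m)
      ≡⟨ substitute a b t (X ^ m) (Y ^ m) ⟩
    secant a b (t * X ^ m) (t * Y ^ m)
      ∎
    where
    substitute : ∀ a b t u₁ u₂ →
      fShape a b t u₁ u₂ (u₁ * u₁) (u₂ * u₂) ≡ secant a b (t * u₁) (t * u₂)
    substitute = solve 5 (λ a b t u₁ u₂ →
      Poly.fShape a b t u₁ u₂ (u₁ :* u₁) (u₂ :* u₂) := Poly.secant a b (t :* u₁) (t :* u₂)) refl

  module _ {a b x₁ x₂ : Carrier} (x₁≢0 : ¬ x₁ ≡ 0#) (x₂≢0 : ¬ x₂ ≡ 0#) where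

    det≡0⇒secant≡0 : ¬ x₁ ≡ x₂ → det (a , b) (cubicPoint x₁) (cubicPoint x₂) ≡ 0# →
                     secant a b x₁ x₂ ≡ 0#
    det≡0⇒secant≡0 x₁≢x₂ d≡0 = x*y≡0⇒y≡0 (x₁≢x₂ ∘ x∙y⁻¹≈ε⇒x≈y x₁ x₂) (begin
      (x₁ - x₂) * secant a b x₁ x₂                            ≡⟨ det-cubicPoints a b x₁≢0 x₂≢0 ⟨
      det (a , b) (cubicPoint x₁) (cubicPoint x₂) * (x₁ * x₂) ≡⟨ ≡.cong (_* (x₁ * x₂)) d≡0 ⟩
      0# * (x₁ * x₂)                                          ≡⟨ zeroˡ (x₁ * x₂) ⟩
      0#                                                      ∎)

    secant≡0⇒det≡0 : secant a b x₁ x₂ ≡ 0# →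
                     det (a , b) (cubicPoint x₁) (cubicPoint x₂) ≡ 0#
    secant≡0⇒det≡0 s≡0 = x*y≡0⇒x≡0 (*-nonzero x₁≢0 x₂≢0) (begin
      det (a , b) (cubicPoint x₁) (cubicPoint x₂) * (x₁ * x₂) ≡⟨ det-cubicPoints a b x₁≢0 x₂≢0 ⟩
      (x₁ - x₂) * secant a b x₁ x₂                            ≡⟨ ≡.cong ((x₁ - x₂) *_) s≡0 ⟩
      (x₁ - x₂) * 0#                                          ≡⟨ zeroʳ (x₁ - x₂) ⟩
      0#                                                      ∎)

  OffDiagonalRoot : ℕ → Carrier → Carrier → Carrier → Set
  OffDiagonalRoot m t a b = ∃ λ x̃ → ∃ λ ỹ →
    ¬ (x̃ ≡ 0#) × ¬ (ỹ ≡ 0#) × ¬ (x̃ ^ m ≡ ỹ ^ m) × f F a b t m x̃ ỹ ≡ 0#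

  module _ {m : ℕ} {t : Carrier} (t≢0 : ¬ t ≡ 0#) {a b : Carrier} where

    private
      t*wᵐ≢0 : ∀ {w} → ¬ w ≡ 0# → ¬ t * w ^ m ≡ 0#
      t*wᵐ≢0 w≢0 = *-nonzero t≢0 (^-nonzero m w≢0)

    collinearWithTwoOfK⇒offDiagonalRoot : DecidableEquality Carrier →
      CollinearWithTwoOfK F m t (a , b) → OffDiagonalRoot m t a b
    collinearWithTwoOfK⇒offDiagonalRoot _≟_
      (_ , _ , (w₁ , w₁≢0 , ≡.refl) , (w₂ , w₂≢0 , ≡.refl) , Q≢R , PQR) =
        w₁ , w₂ , w₁≢0 , w₂≢0 , Q≢R ∘ ≡.cong (λ u → cubicPoint (t * u))
      , ≡.trans (f≡secant a b t m w₁ w₂)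
          (det≡0⇒secant≡0 (t*wᵐ≢0 w₁≢0) (t*wᵐ≢0 w₂≢0) (Q≢R ∘ ≡.cong cubicPoint)
            (collinear⇒det≡0 _≟_ PQR))

    offDiagonalRoot⇒collinearWithTwoOfK :
      OffDiagonalRoot m t a b → CollinearWithTwoOfK F m t (a , b)
    offDiagonalRoot⇒collinearWithTwoOfK (w₁ , w₂ , w₁≢0 , w₂≢0 , w₁ᵐ≢w₂ᵐ , f≡0) =
        cubicPoint x₁ , cubicPoint x₂ , (w₁ , w₁≢0 , ≡.refl) , (w₂ , w₂≢0 , ≡.refl)
      , x₁≢x₂ ∘ ≡.cong proj₁
      , det≡0⇒collinear x₁≢x₂
          (secant≡0⇒det≡0 (t*wᵐ≢0 w₁≢0) (t*wᵐ≢0 w₂≢0)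
            (≡.trans (≡.sym (f≡secant a b t m w₁ w₂)) f≡0))
      where
      x₁ x₂ : Carrier
      x₁ = t * w₁ ^ m
      x₂ = t * w₂ ^ m
      x₁≢x₂ : ¬ x₁ ≡ x₂
      x₁≢x₂ = w₁ᵐ≢w₂ᵐ ∘ *-cancelˡ t≢0

open FieldProperties
open import Data.Nat.Base using (_^_)
open import Data.Product.Base using (_×_)

proposition9 : (p h : ℕ) → Prime p → 3 < p →
    (F : Field) → Field.Carrier F ↔ Fin (p ^ h) →
    (m : ℕ) → m ∣ (p ^ h ∸ 1) → ¬ (m ≡ p ^ h ∸ 1) → gcd m 6 ≡ 1 →
    (t : Field.Carrier F) → ¬ (t ≡ Field.0# F) → ¬ IsPower F m t →
    (a b : Field.Carrier F) → ¬ OnCubic F (a , b) →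
    (CollinearWithTwoOfK F m t (a , b) →
      ∃ λ x̃ → ∃ λ ỹ → ¬ (x̃ ≡ Field.0# F) × ¬ (ỹ ≡ Field.0# F) ×
        ¬ (Field._^_ F x̃ m ≡ Field._^_ F ỹ m) × f F a b t m x̃ ỹ ≡ Field.0# F)
    × ((∃ λ x̃ → ∃ λ ỹ → ¬ (x̃ ≡ Field.0# F) × ¬ (ỹ ≡ Field.0# F) ×
        ¬ (Field._^_ F x̃ m ≡ Field._^_ F ỹ m) × f F a b t m x̃ ỹ ≡ Field.0# F) →
      CollinearWithTwoOfK F m t (a , b))
-- Only t ≠ 0 and the finiteness of F (for decidable equality) are needed.
proposition9 _ _ _ _ F F≅Fin m _ _ _ t t≢0 _ a b _ =
    collinearWithTwoOfK⇒offDiagonalRoot F {m} t≢0 (inj⇒≟ (↔⇒↣ F≅Fin))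
  , offDiagonalRoot⇒collinearWithTwoOfK F {m} t≢0
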